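{- Let $D_1,D_2$ be coprime positive odd integers with $D_2>1$, and consider the equation $$D_1X^2 + D_2Y^2 = 2^{Z+2},\quad X,Y,Z\in\mathbb{Z},\ \gcd(X,Y)=1,\ Z>0.$$ If $(X,Y,Z)$ and $(X',Y',Z')$ are two solutions of this equation in positive integers with $(X,Y,Z)\neq(X',Y',Z')$, then $Z\neq Z'$. -}

module Defs where

open import Data.Nat using (ℕ; _+_; _*_; _^_; _<_)
open import Data.Nat.GCD using (gcd)
open import Data.Product using (_×_)
open import Relation.Binary.PropositionalEquality using (_≡_)

IsPosSolution : ℕ → ℕ → ℕ → ℕ → ℕ → Set
IsPosSolution D₁ D₂ X Y Z =
  (0 < X) × (0 < Y) × (0 < Z) × (gcd X Y ≡ 1) ×
  (D₁ * (X * X) + D₂ * (Y * Y) ≡ 2 ^ (Z + 2))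

{-# OPTIONS --safe #-}
module Submission where

-- Suppose two solutions share Z and put N = 2^(Z+2), a = XY′, b = X′Y (both odd).
-- Eliminating D₂ gives D₁(a² − b²) = N(Y′² − Y²), so N ∣ (a − b)(a + b); since a − b and
-- a + b are even and not both divisible by 4, 2^(Z+1) divides one of them. On the other
-- hand N² = (D₁X² + D₂Y²)(D₁X′² + D₂Y′²) ≥ D₁D₂(a + b)² by AM–GM. So if a ≠ b then
-- D₁D₂ ≤ 4, i.e. D₁ = 1 and D₂ = 3, impossible because X² + 3Y² ≡ 4 (mod 8). Hence a = b,
-- and coprimality of X, Y and of X′, Y′ forces X = X′ and Y = Y′.

open import Data.Empty using (⊥-elim)
open import Data.Nat using (ℕ; zero; suc; _+_; _*_; _^_; _≤_; _<_; s≤s; z≤n; >-nonZero)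
open import Data.Nat.Coprimality using (gcd≡1⇒coprime; coprime-divisor)
open import Data.Nat.Divisibility
open import Data.Nat.GCD using (gcd; gcd-comm)
open import Data.Nat.Primality using (Prime; euclidsLemma; prime[2]; prime⇒nonZero)
open import Data.Nat.Properties
open import Data.Nat.Tactic.RingSolver using (solve-∀)
open import Data.Product using (_×_; _,_; proj₁; proj₂; ∃-syntax)
open import Data.Sum using (_⊎_; inj₁; inj₂; [_,_]′)
import Data.Sum as Sum
open import Function using (_∘_; id; case_of_)
open import Relation.Binary.PropositionalEquality
open import Relation.Nullary using (¬_; yes; no; contradiction)

open import Defs

odd⇒≡1+2* : ∀ {n} → 2 ∤ n → ∃[ k ] n ≡ 1 + 2 * k
odd⇒≡1+2* {zero} 2∤0 = contradiction (2 ∣0) 2∤0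
odd⇒≡1+2* {suc zero} _ = 0 , refl
odd⇒≡1+2* {suc (suc n)} 2∤2+n with odd⇒≡1+2* (2∤2+n ∘ ∣m∣n⇒∣m+n ∣-refl)
... | k , refl = suc k , cong suc (sym (*-suc 2 k))

odd*odd⇒odd : ∀ {m n} → 2 ∤ m → 2 ∤ n → 2 ∤ m * n
odd*odd⇒odd {m} {n} 2∤m 2∤n = [ 2∤m , 2∤n ]′ ∘ euclidsLemma m n prime[2]

odd+odd⇒even : ∀ {m n} → 2 ∤ m → 2 ∤ n → 2 ∣ m + n
odd+odd⇒even 2∤m 2∤n with odd⇒≡1+2* 2∤m | odd⇒≡1+2* 2∤n
... | k , refl | j , refl = divides (1 + k + j) (sum-of-odds k j)
  where
  sum-of-odds : ∀ k j → (1 + 2 * k) + (1 + 2 * j) ≡ (1 + k + j) * 2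
  sum-of-odds = solve-∀

odd-square : ∀ {n} → 2 ∤ n → ∃[ t ] n * n ≡ 1 + 8 * t
odd-square 2∤n with odd⇒≡1+2* 2∤n
... | k , refl = square k
  where
  step : ∀ k → (1 + 2 * suc k) * (1 + 2 * suc k) ≡ (1 + 2 * k) * (1 + 2 * k) + 8 * suc k
  step = solve-∀

  square : ∀ k → ∃[ t ] (1 + 2 * k) * (1 + 2 * k) ≡ 1 + 8 * t
  square zero = 0 , refl
  square (suc k) with square k
  ... | t , eq = t + suc k , (begin
    (1 + 2 * suc k) * (1 + 2 * suc k)      ≡⟨ step k ⟩
    (1 + 2 * k) * (1 + 2 * k) + 8 * suc k  ≡⟨ cong (_+ 8 * suc k) eq ⟩
    1 + 8 * t + 8 * suc k                  ≡⟨ cong suc (sym (*-distribˡ-+ 8 t (suc k))) ⟩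
    1 + 8 * (t + suc k)                    ∎)
    where open ≡-Reasoning

p^k∣m*n⇒p^k∣m : ∀ {p} k {m n} → Prime p → p ∤ n → p ^ k ∣ m * n → p ^ k ∣ m
p^k∣m*n⇒p^k∣m zero _ _ _ = 1∣ _
p^k∣m*n⇒p^k∣m {p} (suc k) {m} {n} p-prime p∤n pᵏ⁺¹∣mn
  with euclidsLemma m n p-prime (∣-trans (m∣m*n (p ^ k)) pᵏ⁺¹∣mn)
... | inj₂ p∣n = contradiction p∣n p∤n
... | inj₁ (divides q refl) = subst (p * p ^ k ∣_) (*-comm p q) (*-monoʳ-∣ p pᵏ∣q)
  where
  reassociate : ∀ q p n → q * p * n ≡ p * (q * n)
  reassociate = solve-∀

  pᵏ∣q : p ^ k ∣ q
  pᵏ∣q = p^k∣m*n⇒p^k∣m k p-prime p∤n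
    (*-cancelˡ-∣ p {{prime⇒nonZero p-prime}}
      (subst (p * p ^ k ∣_) (reassociate q p n) pᵏ⁺¹∣mn))

2^k∣m*[n+m]⇒2^k∣m⊎n+m : ∀ k {n m} → 2 ∤ n → 2 ^ k ∣ m * (n + m) →
  2 ^ k ∣ m ⊎ 2 ^ k ∣ n + m
2^k∣m*[n+m]⇒2^k∣m⊎n+m k {n} {m} 2∤n 2ᵏ∣ with 2 ∣? m
... | yes 2∣m = inj₁ (p^k∣m*n⇒p^k∣m k prime[2] (2∤n ∘ 2∣n) 2ᵏ∣)
  where
  2∣n : 2 ∣ n + m → 2 ∣ n
  2∣n 2∣n+m = ∣m+n∣m⇒∣n (subst (2 ∣_) (+-comm n m) 2∣n+m) 2∣m
... | no 2∤m =
  inj₂ (p^k∣m*n⇒p^k∣m k prime[2] 2∤m (subst (2 ^ k ∣_) (*-comm m (n + m)) 2ᵏ∣))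

2^[2+k]∣e*[b+b+e]⇒2^[1+k]∣e⊎b+b+e : ∀ k {b e} → 2 ∤ b → 2 ∤ b + e →
  2 ^ (2 + k) ∣ e * (b + b + e) → 2 ^ (1 + k) ∣ e ⊎ 2 ^ (1 + k) ∣ b + b + e
2^[2+k]∣e*[b+b+e]⇒2^[1+k]∣e⊎b+b+e k {b} {e} 2∤b 2∤b+e 2^[2+k]∣
  with 2 ∣? e
... | no 2∤e = contradiction (odd+odd⇒even 2∤b 2∤e) 2∤b+e
... | yes (divides v refl) =
  Sum.map (subst (2 * 2 ^ k ∣_) (*-comm 2 v) ∘ *-monoʳ-∣ 2)
          (subst (2 * 2 ^ k ∣_) (double b v) ∘ *-monoʳ-∣ 2)
          (2^k∣m*[n+m]⇒2^k∣m⊎n+m k 2∤b 2ᵏ∣v[b+v])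
  where
  quadruple : ∀ v b → v * 2 * (b + b + v * 2) ≡ 2 * (2 * (v * (b + v)))
  quadruple = solve-∀

  double : ∀ b v → 2 * (b + v) ≡ b + b + v * 2
  double = solve-∀

  2ᵏ∣v[b+v] : 2 ^ k ∣ v * (b + v)
  2ᵏ∣v[b+v] =
    *-cancelˡ-∣ 2 (*-cancelˡ-∣ 2 (subst (2 ^ (2 + k) ∣_) (quadruple v b) 2^[2+k]∣))

2∣m*[n*n]⇒2∣n : ∀ {m n} → 2 ∤ m → 2 ∣ m * (n * n) → 2 ∣ n
2∣m*[n*n]⇒2∣n {m} {n} 2∤m 2∣m*n*n with euclidsLemma m (n * n) prime[2] 2∣m*n*n
... | inj₁ 2∣m = contradiction 2∣m 2∤m
... | inj₂ 2∣n*n = [ id , id ]′ (euclidsLemma n n prime[2] 2∣n*n)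

even-form⇒odd₁ : ∀ {D₁ D₂ X Y} → 2 ∤ D₂ → gcd X Y ≡ 1 →
  2 ∣ D₁ * (X * X) + D₂ * (Y * Y) → 2 ∤ X
even-form⇒odd₁ {D₁} {D₂} {X} {Y} 2∤D₂ gcd≡1 2∣form 2∣X =
  case gcd≡1⇒coprime gcd≡1 (2∣X , 2∣Y) of λ ()
  where
  2∣Y : 2 ∣ Y
  2∣Y = 2∣m*[n*n]⇒2∣n 2∤D₂ (∣m+n∣m⇒∣n 2∣form (∣n⇒∣m*n D₁ (∣m⇒∣m*n X 2∣X)))

even-form⇒odd : ∀ {D₁ D₂ X Y} → 2 ∤ D₁ → 2 ∤ D₂ → gcd X Y ≡ 1 →
  2 ∣ D₁ * (X * X) + D₂ * (Y * Y) → 2 ∤ X × 2 ∤ Y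
even-form⇒odd {D₁} {D₂} {X} {Y} 2∤D₁ 2∤D₂ gcd≡1 2∣form =
  even-form⇒odd₁ {D₁} 2∤D₂ gcd≡1 2∣form ,
  even-form⇒odd₁ {D₂} 2∤D₁ (trans (gcd-comm Y X) gcd≡1)
    (subst (2 ∣_) (+-comm (D₁ * (X * X)) (D₂ * (Y * Y))) 2∣form)

cross-identity : ∀ D₁ D₂ X Y X′ Y′ →
  D₁ * ((X * Y′) * (X * Y′)) + (D₁ * (X′ * X′) + D₂ * (Y′ * Y′)) * (Y * Y) ≡
  D₁ * ((X′ * Y) * (X′ * Y)) + (D₁ * (X * X) + D₂ * (Y * Y)) * (Y′ * Y′)
cross-identity = solve-∀

equal-values⇒∣cross-difference : ∀ D₁ D₂ X Y X′ Y′ {N e} →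
  D₁ * (X * X) + D₂ * (Y * Y) ≡ N → D₁ * (X′ * X′) + D₂ * (Y′ * Y′) ≡ N →
  X′ * Y + e ≡ X * Y′ → N ∣ D₁ * (e * (X′ * Y + X′ * Y + e))
equal-values⇒∣cross-difference D₁ D₂ X Y X′ Y′ {N} {e} value value′ b+e≡a =
  ∣m+n∣m⇒∣n (subst (N ∣_) (sym gap) (m∣m*n (Y′ * Y′))) (m∣m*n (Y * Y))
  where
  open ≡-Reasoning
  b = X′ * Y

  expand : ∀ D b e M →
    D * (b * b) + (M + D * (e * (b + b + e))) ≡ D * ((b + e) * (b + e)) + M
  expand = solve-∀

  gap : N * (Y * Y) + D₁ * (e * (b + b + e)) ≡ N * (Y′ * Y′)
  gap = +-cancelˡ-≡ (D₁ * (b * b)) _ _ (begin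
    D₁ * (b * b) + (N * (Y * Y) + D₁ * (e * (b + b + e)))
      ≡⟨ expand D₁ b e (N * (Y * Y)) ⟩
    D₁ * ((b + e) * (b + e)) + N * (Y * Y)
      ≡⟨ cong (λ a → D₁ * (a * a) + N * (Y * Y)) b+e≡a ⟩
    D₁ * ((X * Y′) * (X * Y′)) + N * (Y * Y)
      ≡⟨ cong (λ M → D₁ * ((X * Y′) * (X * Y′)) + M * (Y * Y)) (sym value′) ⟩
    D₁ * ((X * Y′) * (X * Y′)) + (D₁ * (X′ * X′) + D₂ * (Y′ * Y′)) * (Y * Y)
      ≡⟨ cross-identity D₁ D₂ X Y X′ Y′ ⟩
    D₁ * (b * b) + (D₁ * (X * X) + D₂ * (Y * Y)) * (Y′ * Y′)
      ≡⟨ cong (λ M → D₁ * (b * b) + M * (Y′ * Y′)) value ⟩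
    D₁ * (b * b) + N * (Y′ * Y′) ∎)

2*m*n≤m*m+n*n : ∀ m n → 2 * (m * n) ≤ m * m + n * n
2*m*n≤m*m+n*n m n = [ ordered , swap ∘ ordered ]′ (≤-total m n)
  where
  square-gap : ∀ m o → 2 * (m * (m + o)) + o * o ≡ m * m + (m + o) * (m + o)
  square-gap = solve-∀

  ordered : ∀ {m n} → m ≤ n → 2 * (m * n) ≤ m * m + n * n
  ordered {m} m≤n with m≤n⇒∃[o]m+o≡n m≤n
  ... | o , refl = subst (2 * (m * (m + o)) ≤_) (square-gap m o) (m≤m+n _ (o * o))

  swap : 2 * (n * m) ≤ n * n + m * m → 2 * (m * n) ≤ m * m + n * n
  swap = subst₂ _≤_ (cong (2 *_) (*-comm n m)) (+-comm (n * n) (m * m))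

form-product-bound : ∀ D₁ D₂ X Y X′ Y′ →
  D₁ * D₂ * ((X * Y′ + X′ * Y) * (X * Y′ + X′ * Y)) ≤
  (D₁ * (X * X) + D₂ * (Y * Y)) * (D₁ * (X′ * X′) + D₂ * (Y′ * Y′))
form-product-bound D₁ D₂ X Y X′ Y′ = begin
  D₁ * D₂ * ((X * Y′ + X′ * Y) * (X * Y′ + X′ * Y))
    ≡⟨ square-of-sum D₁ D₂ X Y X′ Y′ ⟩
  2 * (c * d) + r
    ≤⟨ +-monoˡ-≤ r (2*m*n≤m*m+n*n c d) ⟩
  c * c + d * d + r
    ≡⟨ sym (product-of-forms D₁ D₂ X Y X′ Y′) ⟩
  (D₁ * (X * X) + D₂ * (Y * Y)) * (D₁ * (X′ * X′) + D₂ * (Y′ * Y′)) ∎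
  where
  open ≤-Reasoning
  c = D₁ * (X * X′)
  d = D₂ * (Y * Y′)
  r = D₁ * D₂ * ((X * Y′) * (X * Y′) + (X′ * Y) * (X′ * Y))

  square-of-sum : ∀ D₁ D₂ X Y X′ Y′ →
    D₁ * D₂ * ((X * Y′ + X′ * Y) * (X * Y′ + X′ * Y)) ≡
    2 * ((D₁ * (X * X′)) * (D₂ * (Y * Y′))) +
      D₁ * D₂ * ((X * Y′) * (X * Y′) + (X′ * Y) * (X′ * Y))
  square-of-sum = solve-∀

  product-of-forms : ∀ D₁ D₂ X Y X′ Y′ →
    (D₁ * (X * X) + D₂ * (Y * Y)) * (D₁ * (X′ * X′) + D₂ * (Y′ * Y′)) ≡
    (D₁ * (X * X′)) * (D₁ * (X * X′)) + (D₂ * (Y * Y′)) * (D₂ * (Y * Y′)) +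
      D₁ * D₂ * ((X * Y′) * (X * Y′) + (X′ * Y) * (X′ * Y))
  product-of-forms = solve-∀

m*[x*x]≤n*[t*t]⇒m≤n : ∀ m n {t x} → 0 < t → t ≤ x → m * (x * x) ≤ n * (t * t) → m ≤ n
m*[x*x]≤n*[t*t]⇒m≤n m n {t@(suc _)} _ t≤x le =
  *-cancelʳ-≤ m n (t * t) (≤-trans (*-monoʳ-≤ m (*-mono-≤ t≤x t≤x)) le)

odd*odd≤4⇒1*3 : ∀ {m n} → 0 < m → 1 < n → 2 ∤ m → 2 ∤ n → m * n ≤ 4 → m ≡ 1 × n ≡ 3
odd*odd≤4⇒1*3 {1} {1} _ (s≤s ()) _ _ _
odd*odd≤4⇒1*3 {1} {2} _ _ _ 2∤2 _ = contradiction (divides 1 refl) 2∤2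
odd*odd≤4⇒1*3 {1} {3} _ _ _ _ _ = refl , refl
odd*odd≤4⇒1*3 {1} {4} _ _ _ 2∤4 _ = contradiction (divides 2 refl) 2∤4
odd*odd≤4⇒1*3 {1} {suc (suc (suc (suc (suc _))))} _ _ _ _ (s≤s (s≤s (s≤s (s≤s ()))))
odd*odd≤4⇒1*3 {2} _ _ 2∤2 _ _ = contradiction (divides 1 refl) 2∤2
odd*odd≤4⇒1*3 {suc (suc (suc m))} _ 1<n _ _ le
  with ≤-trans (*-mono-≤ {3} {suc (suc (suc m))} (s≤s (s≤s (s≤s z≤n))) 1<n) le
... | s≤s (s≤s (s≤s (s≤s ())))

x²+3y²≢2^[2+z] : ∀ {X Y z} → 0 < z → 2 ∤ X → 2 ∤ Y →
  1 * (X * X) + 3 * (Y * Y) ≢ 2 ^ (2 + z)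
x²+3y²≢2^[2+z] {X} {Y} {suc z} _ 2∤X 2∤Y value with odd-square 2∤X | odd-square 2∤Y
... | t , X²≡ | s , Y²≡ = >⇒∤ (s≤s (s≤s (s≤s (s≤s (s≤s z≤n))))) 8∣4
  where
  open ≡-Reasoning
  residue : ∀ t s → 1 * (1 + 8 * t) + 3 * (1 + 8 * s) ≡ 8 * (t + 3 * s) + 4
  residue = solve-∀

  eightfold : ∀ w → 2 * (2 * (2 * w)) ≡ 8 * w
  eightfold = solve-∀

  form≡ : 8 * (t + 3 * s) + 4 ≡ 2 ^ z * 8
  form≡ = begin
    8 * (t + 3 * s) + 4               ≡⟨ sym (residue t s) ⟩
    1 * (1 + 8 * t) + 3 * (1 + 8 * s) ≡⟨ cong₂ (λ x y → 1 * x + 3 * y) X²≡ Y²≡ ⟨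
    1 * (X * X) + 3 * (Y * Y)         ≡⟨ value ⟩
    2 * (2 * (2 * 2 ^ z))             ≡⟨ eightfold (2 ^ z) ⟩
    8 * 2 ^ z                         ≡⟨ *-comm 8 (2 ^ z) ⟩
    2 ^ z * 8                         ∎

  8∣4 : 8 ∣ 4
  8∣4 = ∣m+n∣m⇒∣n (subst (8 ∣_) (sym form≡) (∣n⇒∣m*n (2 ^ z) ∣-refl))
                   (m∣m*n (t + 3 * s))

coprime-cross⇒∣ : ∀ {X Y X′ Y′} → gcd X Y ≡ 1 → X′ * Y ≡ X * Y′ → X ∣ X′
coprime-cross⇒∣ {X} {Y} {X′} {Y′} gcd≡1 cross =
  coprime-divisor (gcd≡1⇒coprime gcd≡1)
    (divides Y′ (trans (*-comm Y X′) (trans cross (*-comm X Y′))))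

coprime-cross⇒≡ : ∀ {X Y X′ Y′} → 0 < X → gcd X Y ≡ 1 → gcd X′ Y′ ≡ 1 →
  X′ * Y ≡ X * Y′ → X ≡ X′ × Y ≡ Y′
coprime-cross⇒≡ {X} {Y} {X′} {Y′} 0<X gcd≡1 gcd′≡1 cross =
  X≡X′ , *-cancelˡ-≡ Y Y′ X {{>-nonZero 0<X}} (trans (cong (_* Y) X≡X′) cross)
  where
  X≡X′ : X ≡ X′
  X≡X′ = ∣-antisym (coprime-cross⇒∣ gcd≡1 cross) (coprime-cross⇒∣ gcd′≡1 (sym cross))

distinct-crosses⇒D₁D₂≤4 : ∀ {D₁ D₂ X Y X′ Y′ k e} →
  2 ∤ D₁ → 2 ∤ X′ * Y → 2 ∤ X * Y′ → 0 < e →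
  D₁ * (X * X) + D₂ * (Y * Y) ≡ 2 ^ (2 + k) → D₁ * (X′ * X′) + D₂ * (Y′ * Y′) ≡ 2 ^ (2 + k) →
  X′ * Y + e ≡ X * Y′ → D₁ * D₂ ≤ 4
distinct-crosses⇒D₁D₂≤4 {D₁} {D₂} {X} {Y} {X′} {Y′} {k} {e}
  2∤D₁ 2∤b 2∤a 0<e value value′ b+e≡a =
  m*[x*x]≤n*[t*t]⇒m≤n (D₁ * D₂) 4 (m^n>0 2 (1 + k)) T≤b+b+e bound
  where
  b = X′ * Y
  T = 2 ^ (1 + k)

  N∣e[b+b+e] : 2 ^ (2 + k) ∣ e * (b + b + e)
  N∣e[b+b+e] = p^k∣m*n⇒p^k∣m (2 + k) prime[2] 2∤D₁
    (subst (2 ^ (2 + k) ∣_) (*-comm D₁ (e * (b + b + e)))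
      (equal-values⇒∣cross-difference D₁ D₂ X Y X′ Y′ value value′ b+e≡a))

  e≤b+b+e : e ≤ b + b + e
  e≤b+b+e = m≤n+m e (b + b)

  T≤b+b+e : T ≤ b + b + e
  T≤b+b+e
    with 2^[2+k]∣e*[b+b+e]⇒2^[1+k]∣e⊎b+b+e k 2∤b (subst (2 ∤_) (sym b+e≡a) 2∤a) N∣e[b+b+e]
  ... | inj₁ T∣e = ≤-trans (∣⇒≤ {{>-nonZero 0<e}} T∣e) e≤b+b+e
  ... | inj₂ T∣b+b+e = ∣⇒≤ {{>-nonZero (≤-trans 0<e e≤b+b+e)}} T∣b+b+e

  rearrange : ∀ b e → b + e + b ≡ b + b + e
  rearrange = solve-∀

  cross-sum : X * Y′ + b ≡ b + b + e
  cross-sum = trans (cong (_+ b) (sym b+e≡a)) (rearrange b e)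

  doubled : ∀ t → (2 * t) * (2 * t) ≡ 4 * (t * t)
  doubled = solve-∀

  bound : D₁ * D₂ * ((b + b + e) * (b + b + e)) ≤ 4 * (T * T)
  bound = subst₂ (λ s M → D₁ * D₂ * (s * s) ≤ M) cross-sum
    (trans (cong₂ _*_ value value′) (doubled T)) (form-product-bound D₁ D₂ X Y X′ Y′)

same-level-solutions-coincide : ∀ {D₁ D₂ X Y X′ Y′ Z} → 0 < D₁ → 1 < D₂ → 2 ∤ D₁ → 2 ∤ D₂ →
  IsPosSolution D₁ D₂ X Y Z → IsPosSolution D₁ D₂ X′ Y′ Z → X′ * Y ≤ X * Y′ → X ≡ X′ × Y ≡ Y′
same-level-solutions-coincide {D₁} {D₂} {X} {Y} {X′} {Y′} {Z} 0<D₁ 1<D₂ 2∤D₁ 2∤D₂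
  (0<X , _ , 0<Z , gcd≡1 , value) (_ , _ , _ , gcd′≡1 , value′) b≤a =
  case m≤n⇒∃[o]m+o≡n b≤a of λ where
    (zero , b+0≡a) → coprime-cross⇒≡ 0<X gcd≡1 gcd′≡1 (trans (sym (+-identityʳ _)) b+0≡a)
    (suc e , b+e≡a) → ⊥-elim (¬[D₁≡1×D₂≡3] (odd*odd≤4⇒1*3 0<D₁ 1<D₂ 2∤D₁ 2∤D₂ (D₁D₂≤4 b+e≡a)))
  where
  level : 2 ^ (Z + 2) ≡ 2 ^ (2 + Z)
  level = cong (2 ^_) (+-comm Z 2)

  valueₙ : D₁ * (X * X) + D₂ * (Y * Y) ≡ 2 ^ (2 + Z)
  valueₙ = trans value level

  valueₙ′ : D₁ * (X′ * X′) + D₂ * (Y′ * Y′) ≡ 2 ^ (2 + Z)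
  valueₙ′ = trans value′ level

  odd-components : ∀ X Y → gcd X Y ≡ 1 → D₁ * (X * X) + D₂ * (Y * Y) ≡ 2 ^ (2 + Z) →
    2 ∤ X × 2 ∤ Y
  odd-components X Y gcd≡1 value =
    even-form⇒odd 2∤D₁ 2∤D₂ gcd≡1 (subst (2 ∣_) (sym value) (m∣m*n (2 ^ (1 + Z))))

  2∤X : 2 ∤ X
  2∤X = proj₁ (odd-components X Y gcd≡1 valueₙ)

  2∤Y : 2 ∤ Y
  2∤Y = proj₂ (odd-components X Y gcd≡1 valueₙ)

  2∤X′ : 2 ∤ X′
  2∤X′ = proj₁ (odd-components X′ Y′ gcd′≡1 valueₙ′)

  2∤Y′ : 2 ∤ Y′
  2∤Y′ = proj₂ (odd-components X′ Y′ gcd′≡1 valueₙ′)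

  D₁D₂≤4 : ∀ {e} → X′ * Y + suc e ≡ X * Y′ → D₁ * D₂ ≤ 4
  D₁D₂≤4 = distinct-crosses⇒D₁D₂≤4 {D₁} {D₂} {X} {Y} {X′} {Y′} {Z} 2∤D₁
    (odd*odd⇒odd 2∤X′ 2∤Y) (odd*odd⇒odd 2∤X 2∤Y′) (s≤s z≤n) valueₙ valueₙ′

  ¬[D₁≡1×D₂≡3] : ¬ (D₁ ≡ 1 × D₂ ≡ 3)
  ¬[D₁≡1×D₂≡3] (refl , refl) = x²+3y²≢2^[2+z] 0<Z 2∤X 2∤Y valueₙ

lemma2p14 : (D₁ D₂ : ℕ) → 0 < D₁ → 1 < D₂ → ¬ (2 ∣ D₁) → ¬ (2 ∣ D₂) → gcd D₁ D₂ ≡ 1 →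
    (X Y Z X′ Y′ Z′ : ℕ) → IsPosSolution D₁ D₂ X Y Z → IsPosSolution D₁ D₂ X′ Y′ Z′ →
    ¬ ((X , Y , Z) ≡ (X′ , Y′ , Z′)) → Z ≢ Z′
lemma2p14 D₁ D₂ 0<D₁ 1<D₂ 2∤D₁ 2∤D₂ _ X Y Z X′ Y′ Z′ sol sol′ distinct refl =
  case ≤-total (X′ * Y) (X * Y′) of λ where
    (inj₁ X′Y≤XY′) → case coincide sol sol′ X′Y≤XY′ of λ where
      (refl , refl) → distinct refl
    (inj₂ XY′≤X′Y) → case coincide sol′ sol XY′≤X′Y of λ where
      (refl , refl) → distinct refl
  where
  coincide : ∀ {X Y X′ Y′} → IsPosSolution D₁ D₂ X Y Z → IsPosSolution D₁ D₂ X′ Y′ Z →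
    X′ * Y ≤ X * Y′ → X ≡ X′ × Y ≡ Y′
  coincide = same-level-solutions-coincide 0<D₁ 1<D₂ 2∤D₁ 2∤D₂
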